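{- For any graph $G$ without isolated vertices, $sp_1(G)=sp_2(G)=sp_3(G)$, where $sp_1(G)=\min\{k: G \text{ has a } [1,k]\text{ -factor}\}$, $sp_2(G)=\min\{k: G \text{ has a spanning } k\text{ -edge-colorable subgraph}\}$, and $sp_3(G)=\min\{k: G \text{ has a spanning maximum } k\text{ -edge-colorable subgraph}\}$.
   Context: Graphs are finite, undirected, without loops, but may have multiple edges. For non-negative integers $a\le b$, an $[a,b]$-factor of $G$ is a subgraph $H$ with $V(H)=V(G)$ and $a\le d_H(v)\le b$ for every vertex $v$. A subgraph $H$ of $G$ is spanning if every vertex of $G$ has degree at least $1$ in $H$. A graph is $k$-edge-colorable if its edge set can be partitioned into $k$ matchings. A maximum $k$-edge-colorable subgraph of $G$ is a $k$-edge-colorable subgraph of $G$ with the maximum possible number of edges. -}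

module Defs where

open import Data.Nat using (ℕ; zero; suc; _+_; _≤_)
open import Data.Fin using (Fin; zero; suc; _≟_)
open import Data.Bool using (Bool; true; false; _∨_; if_then_else_)
open import Data.Product using (Σ; ∃; _×_; _,_; proj₁; proj₂)
open import Relation.Nullary using (¬_)
open import Relation.Nullary.Decidable using (⌊_⌋)
open import Relation.Binary.PropositionalEquality using (_≡_)

-- A finite loopless multigraph: n vertices (Fin n), m edges (Fin m),
-- each edge has two distinct endpoints. Parallel edges are allowed.
record Graph : Set where
  field
    n      : ℕ
    m      : ℕ
    ends   : Fin m → Fin n × Fin n
    noLoop : (e : Fin m) → ¬ (proj₁ (ends e) ≡ proj₂ (ends e))
open Graph public

count : (k : ℕ) → (Fin k → Bool) → ℕ
count zero    p = 0
count (suc k) p = (if p zero then 1 else 0) + count k (λ i → p (suc i))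

incident : (G : Graph) → Fin (m G) → Fin (n G) → Bool
incident G e v = ⌊ proj₁ (ends G e) ≟ v ⌋ ∨ ⌊ proj₂ (ends G e) ≟ v ⌋

-- A spanning-vertex-set subgraph H of G (V(H) = V(G)) given by its edge set.
Subgraph : Graph → Set
Subgraph G = Fin (m G) → Bool

-- degree of v in H (no loops, so each incident edge counts once)
deg : (G : Graph) → Subgraph G → Fin (n G) → ℕ
deg G H v = count (m G) (λ e → if H e then incident G e v else false)

size : (G : Graph) → Subgraph G → ℕ
size G H = count (m G) H

NoIsolated : Graph → Set
NoIsolated G = (v : Fin (n G)) → ∃ λ e → incident G e v ≡ true

IsFactor : (G : Graph) → ℕ → ℕ → Subgraph G → Set
IsFactor G a b H = (v : Fin (n G)) → (a ≤ deg G H v) × (deg G H v ≤ b)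

IsSpanning : (G : Graph) → Subgraph G → Set
IsSpanning G H = (v : Fin (n G)) → 1 ≤ deg G H v

Adjacent : (G : Graph) → Fin (m G) → Fin (m G) → Set
Adjacent G e f = ∃ λ v → (incident G e v ≡ true) × (incident G f v ≡ true)

EdgeColorable : (G : Graph) → ℕ → Subgraph G → Set
EdgeColorable G k H =
  Σ (Fin (m G) → Fin k) λ c →
    (e f : Fin (m G)) → ¬ (e ≡ f) → H e ≡ true → H f ≡ true →
    Adjacent G e f → ¬ (c e ≡ c f)

IsMaxEdgeColorable : (G : Graph) → ℕ → Subgraph G → Set
IsMaxEdgeColorable G k H =
  EdgeColorable G k H × ((H' : Subgraph G) → EdgeColorable G k H' → size G H' ≤ size G H)

IsMin : (ℕ → Set) → ℕ → Set
IsMin P k = P k × ((j : ℕ) → P j → k ≤ j)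

SP1 : Graph → ℕ → Set
SP1 G k = ∃ λ (H : Subgraph G) → IsFactor G 1 k H

SP2 : Graph → ℕ → Set
SP2 G k = ∃ λ (H : Subgraph G) → IsSpanning G H × EdgeColorable G k H

SP3 : Graph → ℕ → Set
SP3 G k = ∃ λ (H : Subgraph G) → IsSpanning G H × IsMaxEdgeColorable G k H

module Submission where

-- For each fixed k we show SP1 k → SP3 k → SP2 k → SP1 k, so
-- the three predicates have the same minimum, which exists because the
-- whole edge set is a [1,m]-factor and SP1 is decidable.
--
-- SP3 → SP2 is immediate and SP2 → SP1 holds because a proper colouring
-- with k colours bounds all degrees by k.  The content is SP1 → SP3:
-- given a [1,k]-factor F, choose a maximum k-colourable subgraph H sharing
-- as many edges with F as possible.  If H missed a vertex v, take the edge
-- e = vu of F at v.  If some colour is free at u, adding e gives a larger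
-- colourable subgraph; otherwise u has H-degree k ≥ F-degree, so some
-- H-edge f at u lies outside F, and giving e the colour of f in place of f
-- keeps the size but increases the overlap with F.

open import Defs
open import Data.Nat using (ℕ; zero; suc; _+_; _≤_; _<_; z≤n; s≤s; _≤?_; _<?_)
import Data.Nat.Properties as ℕ
open import Data.Nat.Properties
  using (≤-refl; ≤-reflexive; ≤-trans; ≮⇒≥; ≤∧≢⇒<; <⇒≱; n≮n; module ≤-Reasoning)
open import Algebra.Properties.CommutativeSemigroup ℕ.+-commutativeSemigroup
  using (x∙yz≈y∙xz)
open import Data.Nat.Induction using (<-rec)
open import Data.Fin using (Fin; zero; suc; punchIn; punchOut; fromℕ<; _≟_)
open import Data.Fin.Properties
  using (any?; all?; punchInᵢ≢i; punchIn-punchOut; punchOut-injective; suc-injective)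
open import Data.Vec.Functional using (updateAt; _∷_)
open import Data.Vec.Functional.Properties using (updateAt-updates; updateAt-minimal)
open import Data.Bool using (Bool; true; false; if_then_else_; _∧_)
import Data.Bool.Properties as Bool
open import Data.Product using (∃; _×_; _,_; proj₁; proj₂)
open import Data.Sum using (_⊎_; inj₁; inj₂)
open import Data.Empty using (⊥; ⊥-elim)
open import Function using (_∘_; const)
open import Relation.Nullary using (¬_; Dec; yes; no; contradiction)
open import Relation.Nullary.Decidable using (_×-dec_; _→-dec_; ¬?)
open import Relation.Unary using (Decidable)
open import Relation.Binary.PropositionalEquality
  using (_≡_; _≢_; _≗_; refl; sym; trans; cong; cong₂; module ≡-Reasoning)

[_] : Bool → ℕ
[ b ] = if b then 1 else 0

_[_]≔_ : {A : Set} {k : ℕ} → (Fin k → A) → Fin k → A → Fin k → A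
p [ e ]≔ b = updateAt p e (const b)

≔-updates : ∀ {A k} (p : Fin k → A) e b → (p [ e ]≔ b) e ≡ b
≔-updates p e b = updateAt-updates e p

≔-minimal : ∀ {A k} (p : Fin k → A) e b i → i ≢ e → (p [ e ]≔ b) i ≡ p i
≔-minimal p e b i i≢e = updateAt-minimal i e p i≢e

count-cong : ∀ {k} {p q : Fin k → Bool} → p ≗ q → count k p ≡ count k q
count-cong {zero}          p≗q = refl
count-cong {suc k} {q = q} p≗q rewrite p≗q zero = cong ([ q zero ] +_) (count-cong (p≗q ∘ suc))

count-true : ∀ k → count k (const true) ≡ k
count-true zero    = refl
count-true (suc k) = cong suc (count-true k)

count-split : ∀ {k} (q : Fin (suc k) → Bool) (e : Fin (suc k)) →
  count (suc k) q ≡ [ q e ] + count k (q ∘ punchIn e)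
count-split q zero = refl
count-split {suc k} q (suc e) = begin
  [ q zero ] + count (suc k) (q ∘ suc)
    ≡⟨ cong ([ q zero ] +_) (count-split (q ∘ suc) e) ⟩
  [ q zero ] + ([ q (suc e) ] + count k (q ∘ suc ∘ punchIn e))
    ≡⟨ x∙yz≈y∙xz [ q zero ] [ q (suc e) ] _ ⟩
  [ q (suc e) ] + ([ q zero ] + count k (q ∘ suc ∘ punchIn e)) ∎
  where open ≡-Reasoning

count-update : ∀ {k} (p : Fin (suc k) → Bool) (e : Fin (suc k)) (b : Bool) →
  count (suc k) (p [ e ]≔ b) ≡ [ b ] + count k (p ∘ punchIn e)
count-update {k} p e b = begin
  count (suc k) (p [ e ]≔ b)
    ≡⟨ count-split (p [ e ]≔ b) e ⟩
  [ (p [ e ]≔ b) e ] + count k ((p [ e ]≔ b) ∘ punchIn e)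
    ≡⟨ cong₂ _+_ (cong [_] (≔-updates p e b))
                 (count-cong (λ i → ≔-minimal p e b (punchIn e i) (punchInᵢ≢i e i))) ⟩
  [ b ] + count k (p ∘ punchIn e) ∎
  where open ≡-Reasoning

count-insert : ∀ {k} (p : Fin k → Bool) (e : Fin k) → p e ≡ false →
  count k (p [ e ]≔ true) ≡ suc (count k p)
count-insert {suc k} p e pe = begin
  count (suc k) (p [ e ]≔ true)      ≡⟨ count-update p e true ⟩
  suc (count k (p ∘ punchIn e))      ≡⟨ cong (λ b → suc ([ b ] + count k (p ∘ punchIn e))) (sym pe) ⟩
  suc ([ p e ] + count k (p ∘ punchIn e)) ≡⟨ cong suc (sym (count-split p e)) ⟩
  suc (count (suc k) p) ∎
  where open ≡-Reasoning

count-delete : ∀ {k} (p : Fin k → Bool) (e : Fin k) → p e ≡ true →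
  count k p ≡ suc (count k (p [ e ]≔ false))
count-delete {suc k} p e pe = begin
  count (suc k) p                      ≡⟨ count-split p e ⟩
  [ p e ] + count k (p ∘ punchIn e)    ≡⟨ cong (λ b → [ b ] + count k (p ∘ punchIn e)) pe ⟩
  suc (count k (p ∘ punchIn e))        ≡⟨ cong suc (sym (count-update p e false)) ⟩
  suc (count (suc k) (p [ e ]≔ false)) ∎
  where open ≡-Reasoning

-- The map may use the proof
-- that its argument is a true entry, which is what lets us punch out the
-- image of the first entry in the induction step.
count-injection : ∀ {a b} (p : Fin a → Bool) (q : Fin b → Bool)
  (g : ∀ i → p i ≡ true → Fin b) →
  (∀ i pi → q (g i pi) ≡ true) →
  (∀ i j pi pj → g i pi ≡ g j pj → i ≡ j) →
  count a p ≤ count b q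
count-injection {zero} p q g into inj = z≤n
count-injection {suc a} p q g into inj with p zero in p₀
... | false = count-injection (p ∘ suc) q (g ∘ suc) (into ∘ suc)
                (λ i j pi pj → suc-injective ∘ inj (suc i) (suc j) pi pj)
... | true  = remove-first q g into inj p₀
  where
  remove-first : ∀ {b} (q : Fin b → Bool) (g : ∀ i → p i ≡ true → Fin b) →
    (∀ i pi → q (g i pi) ≡ true) → (∀ i j pi pj → g i pi ≡ g j pj → i ≡ j) →
    p zero ≡ true → suc (count a (p ∘ suc)) ≤ count b q
  remove-first {zero}  q g into inj p₀ with () ← g zero p₀
  remove-first {suc b} q g into inj p₀ = begin
    suc (count a (p ∘ suc))          ≤⟨ s≤s (count-injection (p ∘ suc) (q ∘ punchIn j₀) g′ into′ inj′) ⟩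
    suc (count b (q ∘ punchIn j₀))   ≡⟨ cong (λ x → [ x ] + count b (q ∘ punchIn j₀)) (sym (into zero p₀)) ⟩
    [ q j₀ ] + count b (q ∘ punchIn j₀) ≡⟨ sym (count-split q j₀) ⟩
    count (suc b) q ∎
    where
    open ≤-Reasoning
    j₀ = g zero p₀
    apart : ∀ i pi → j₀ ≢ g (suc i) pi
    apart i pi eq with () ← inj zero (suc i) p₀ pi eq
    g′ : ∀ i → p (suc i) ≡ true → Fin b
    g′ i pi = punchOut (apart i pi)
    into′ : ∀ i pi → q (punchIn j₀ (g′ i pi)) ≡ true
    into′ i pi = trans (cong q (punchIn-punchOut (apart i pi))) (into (suc i) pi)
    inj′ : ∀ i j pi pj → g′ i pi ≡ g′ j pj → i ≡ j
    inj′ i j pi pj = suc-injective ∘ inj (suc i) (suc j) pi pj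
                     ∘ punchOut-injective (apart i pi) (apart j pj)

count-mono : ∀ {k} (p q : Fin k → Bool) → (∀ i → p i ≡ true → q i ≡ true) → count k p ≤ count k q
count-mono p q p⊆q = count-injection p q (λ i _ → i) p⊆q (λ _ _ _ _ eq → eq)

count-≤ : ∀ {k} (p : Fin k → Bool) → count k p ≤ k
count-≤ {k} p = ≤-trans (count-mono p (const true) (λ _ _ → refl)) (≤-reflexive (count-true k))

count-positive : ∀ {k} (p : Fin k → Bool) (i : Fin k) → p i ≡ true → 1 ≤ count k p
count-positive {suc k} p i pi rewrite count-split p i | pi = s≤s z≤n

count-witness : ∀ {k} (p : Fin k → Bool) → 1 ≤ count k p → ∃ λ i → p i ≡ true
count-witness {suc k} p pos with p zero in p₀
... | true  = zero , p₀
... | false = let i , pi = count-witness (p ∘ suc) pos in suc i , pi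

exchange : ∀ {k} → (Fin k → Bool) → Fin k → Fin k → Fin k → Bool
exchange p f e = (p [ f ]≔ false) [ e ]≔ true

count-exchange : ∀ {k} (p : Fin k → Bool) f e → p f ≡ true → p e ≡ false →
  count k (exchange p f e) ≡ count k p
count-exchange {k} p f e pf pe = begin
  count k (exchange p f e)        ≡⟨ count-insert (p [ f ]≔ false) e (trans (≔-minimal p f false e e≢f) pe) ⟩
  suc (count k (p [ f ]≔ false))  ≡⟨ sym (count-delete p f pf) ⟩
  count k p ∎
  where
  open ≡-Reasoning
  e≢f : e ≢ f
  e≢f refl with () ← trans (sym pf) pe

count-exchange-∧ : ∀ {k} (p q : Fin k → Bool) f e → p e ≡ false → q f ≡ false → q e ≡ true →
  count k (λ i → exchange p f e i ∧ q i) ≡ suc (count k (λ i → p i ∧ q i))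
count-exchange-∧ {k} p q f e pe qf qe = begin
  count k (λ i → exchange p f e i ∧ q i)   ≡⟨ count-cong pointwise ⟩
  count k (p∧q [ e ]≔ true)                ≡⟨ count-insert p∧q e (cong (_∧ q e) pe) ⟩
  suc (count k p∧q) ∎
  where
  open ≡-Reasoning
  p∧q : Fin k → Bool
  p∧q i = p i ∧ q i
  pointwise : ∀ i → exchange p f e i ∧ q i ≡ (p∧q [ e ]≔ true) i
  pointwise i with i ≟ e
  ... | yes refl rewrite ≔-updates (p [ f ]≔ false) i true | ≔-updates p∧q i true = qe
  ... | no i≢e rewrite ≔-minimal (p [ f ]≔ false) e true i i≢e | ≔-minimal p∧q e true i i≢e
    with i ≟ f
  ... | yes refl rewrite ≔-updates p i false | qf = sym (Bool.∧-zeroʳ (p i))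
  ... | no i≢f rewrite ≔-minimal p f false i i≢f = refl

count-surplus : ∀ {k} (p q : Fin k → Bool) e → count k q ≤ count k p →
  q e ≡ true → p e ≡ false → ∃ λ f → p f ≡ true × q f ≡ false
count-surplus {k} p q e q≤p qe pe
  with any? (λ f → (p f Bool.≟ true) ×-dec (q f Bool.≟ false))
... | yes surplus = surplus
... | no none = contradiction q≤p (<⇒≱ (begin-strict
      count k p                 <⟨ ℕ.n<1+n _ ⟩
      suc (count k p)           ≡⟨ sym (count-insert p e pe) ⟩
      count k (p [ e ]≔ true)   ≤⟨ count-mono _ q inserted⊆q ⟩
      count k q ∎))
  where
  open ≤-Reasoning
  p⊆q : ∀ i → p i ≡ true → q i ≡ true
  p⊆q i pi with q i in qi
  ... | true  = refl
  ... | false = ⊥-elim (none (i , pi , qi))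
  inserted⊆q : ∀ i → (p [ e ]≔ true) i ≡ true → q i ≡ true
  inserted⊆q i pi with i ≟ e
  ... | yes refl = qe
  ... | no i≢e   = p⊆q i (trans (sym (≔-minimal p e true i i≢e)) pi)

Searchable : Set → Set₁
Searchable A = (P : A → Set) → Decidable P → Dec (∃ P)

searchable-Bool : Searchable Bool
searchable-Bool P P? with P? true | P? false
... | yes pt | _      = yes (true , pt)
... | no _   | yes pf = yes (false , pf)
... | no ¬pt | no ¬pf = no λ { (true , pt) → ¬pt pt ; (false , pf) → ¬pf pf }

searchable-Fin : ∀ {k} → Searchable (Fin k)
searchable-Fin P P? = any? P?

-- Predicates on finite functions that only depend on the values.
-- (Without function extensionality this has to be assumed explicitly.)
Extensional : {A : Set} {m : ℕ} → ((Fin m → A) → Set) → Set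
Extensional R = ∀ {f g} → f ≗ g → R f → R g

search-functions : ∀ {A} → Searchable A → ∀ m (R : (Fin m → A) → Set) →
  Extensional R → Decidable R → Dec (∃ R)
search-functions search zero R ext R? with R? (λ ())
... | yes r = yes (_ , r)
... | no ¬r = no λ (f , r) → ¬r (ext (λ ()) r)
search-functions search (suc m) R ext R? with search (λ a → ∃ λ g → R (a ∷ g)) first?
  where
  first? : Decidable (λ a → ∃ λ g → R (a ∷ g))
  first? a = search-functions search m (λ g → R (a ∷ g))
               (λ g≗g′ → ext λ { zero → refl ; (suc i) → g≗g′ i }) (λ g → R? (a ∷ g))
... | yes (a , g , r) = yes (a ∷ g , r)
... | no none = no λ (f , r) →
        none (f zero , f ∘ suc , ext (λ { zero → refl ; (suc i) → refl }) r)

least : {P : ℕ → Set} → Decidable P → ∀ N → P N → ∃ (IsMin P)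
least {P} P? = <-rec (λ N → P N → ∃ (IsMin P)) step
  where
  step : ∀ N → (∀ {j} → j < N → P j → ∃ (IsMin P)) → P N → ∃ (IsMin P)
  step N below pN with ℕ.anyUpTo? P? N
  ... | yes (j , j<N , pj) = below j<N pj
  ... | no none = N , pN , λ j pj → ≮⇒≥ λ j<N → none (j , j<N , pj)

largest : {P : ℕ → Set} → Decidable P → ∀ B → (∀ t → P t → t ≤ B) →
  ∃ P → ∃ λ t → P t × (∀ s → P s → s ≤ t)
largest P? zero    bounded (t , pt) = t , pt , λ s ps → ≤-trans (bounded s ps) z≤n
largest {P} P? (suc B) bounded inhabited with P? (suc B)
... | yes pB = suc B , pB , bounded
... | no ¬pB = largest P? B below-B inhabited
  where
  below-B : ∀ t → P t → t ≤ B
  below-B t pt = ℕ.≤-pred (≤∧≢⇒< (bounded t pt) λ { refl → ¬pB pt })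

maximise : ∀ {A m} → Searchable A → (Q : (Fin m → A) → Set) → Extensional Q → Decidable Q →
  (μ : (Fin m → A) → ℕ) → (∀ {f g} → f ≗ g → μ f ≡ μ g) → (B : ℕ) → (∀ f → μ f ≤ B) →
  ∃ Q → ∃ λ f → Q f × (∀ g → Q g → μ g ≤ μ f)
maximise {m = m} search Q ext Q? μ μ-cong B bounded (f , qf)
  with largest reaches? B (λ t (g , _ , t≤μg) → ≤-trans t≤μg (bounded g)) (μ f , f , qf , ≤-refl)
  where
  Reaches : ℕ → Set
  Reaches t = ∃ λ g → Q g × t ≤ μ g
  reaches? : Decidable Reaches
  reaches? t = search-functions search m (λ g → Q g × t ≤ μ g)
                 (λ f≗g (qf , le) → ext f≗g qf , ≤-trans le (≤-reflexive (μ-cong f≗g)))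
                 (λ g → Q? g ×-dec (t ≤? μ g))
... | t , (g , qg , t≤μg) , top = g , qg , λ h qh → ≤-trans (top (μ h) (h , qh , ≤-refl)) t≤μg

module _ (G : Graph) where

  Edge : Set
  Edge = Fin (m G)

  Vertex : Set
  Vertex = Fin (n G)

  -- The edges of H at v; deg G H v is by definition the count of this vector.
  _at_ : Subgraph G → Vertex → Edge → Bool
  (H at v) e = if H e then incident G e v else false

  at-intro : ∀ H v e → H e ≡ true → incident G e v ≡ true → (H at v) e ≡ true
  at-intro H v e He e∋v rewrite He = e∋v

  at-elim : ∀ H v e → (H at v) e ≡ true → H e ≡ true × incident G e v ≡ true
  at-elim H v e at with H e
  ... | true = refl , at

  at-absent : ∀ H v e → H e ≡ false → (H at v) e ≡ false
  at-absent H v e He rewrite He = refl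

  at-outside : ∀ H v e → (H at v) e ≡ false → incident G e v ≡ true → H e ≡ false
  at-outside H v e at e∋v with H e
  ... | true  = trans (sym e∋v) at
  ... | false = refl

  deg-cong : ∀ {H H′} v → H ≗ H′ → deg G H v ≡ deg G H′ v
  deg-cong v H≗H′ = count-cong (λ e → cong (λ b → if b then incident G e v else false) (H≗H′ e))

  covers : ∀ H v e → H e ≡ true → incident G e v ≡ true → 1 ≤ deg G H v
  covers H v e He e∋v = count-positive (H at v) e (at-intro H v e He e∋v)

  edge-at : ∀ H v → 1 ≤ deg G H v → ∃ λ e → H e ≡ true × incident G e v ≡ true
  edge-at H v covered = let e , at = count-witness (H at v) covered in e , at-elim H v e at

  incident-ends : ∀ e x → incident G e x ≡ true → x ≡ proj₁ (ends G e) ⊎ x ≡ proj₂ (ends G e)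
  incident-ends e x e∋x with proj₁ (ends G e) ≟ x | proj₂ (ends G e) ≟ x
  ... | yes refl | _        = inj₁ refl
  ... | no _     | yes refl = inj₂ refl

  incident-end₁ : ∀ e → incident G e (proj₁ (ends G e)) ≡ true
  incident-end₁ e with proj₁ (ends G e) ≟ proj₁ (ends G e)
  ... | yes _ = refl
  ... | no x≢x = contradiction refl x≢x

  incident-end₂ : ∀ e → incident G e (proj₂ (ends G e)) ≡ true
  incident-end₂ e with proj₁ (ends G e) ≟ proj₂ (ends G e) | proj₂ (ends G e) ≟ proj₂ (ends G e)
  ... | yes _ | _     = refl
  ... | no _  | yes _ = refl
  ... | no _  | no y≢y = contradiction refl y≢y

  other-end : ∀ e v → incident G e v ≡ true →
    ∃ λ u → incident G e u ≡ true × (∀ x → incident G e x ≡ true → x ≡ v ⊎ x ≡ u)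
  other-end e v e∋v with incident-ends e v e∋v
  ... | inj₁ refl = proj₂ (ends G e) , incident-end₂ e , incident-ends e
  ... | inj₂ refl = proj₁ (ends G e) , incident-end₁ e , λ x e∋x → swap (incident-ends e x e∋x)
    where
    swap : ∀ {A B : Set} → A ⊎ B → B ⊎ A
    swap (inj₁ a) = inj₂ a
    swap (inj₂ b) = inj₁ b

  Proper : ∀ k → Subgraph G → (Edge → Fin k) → Set
  Proper k H c = (e f : Edge) → ¬ (e ≡ f) → H e ≡ true → H f ≡ true →
    Adjacent G e f → ¬ (c e ≡ c f)

  adjacent? : ∀ e f → Dec (Adjacent G e f)
  adjacent? e f = any? λ x → (incident G e x Bool.≟ true) ×-dec (incident G f x Bool.≟ true)

  proper? : ∀ k H → Decidable (Proper k H)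
  proper? k H c = all? λ e → all? λ f →
    ¬? (e ≟ f) →-dec (H e Bool.≟ true) →-dec (H f Bool.≟ true) →-dec adjacent? e f →-dec ¬? (c e ≟ c f)

  proper-ext : ∀ k H → Extensional (Proper k H)
  proper-ext k H c≗c′ proper e f e≢f He Hf adj eq =
    proper e f e≢f He Hf adj (trans (c≗c′ e) (trans eq (sym (c≗c′ f))))

  colourable-ext : ∀ k → Extensional (EdgeColorable G k)
  colourable-ext k H≗H′ (c , proper) =
    c , λ e f e≢f He Hf → proper e f e≢f (trans (H≗H′ e) He) (trans (H≗H′ f) Hf)

  colourable? : ∀ k → Decidable (EdgeColorable G k)
  colourable? k H = search-functions searchable-Fin (m G) (Proper k H) (proper-ext k H) (proper? k H)

  factor-ext : ∀ a b → Extensional (IsFactor G a b)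
  factor-ext a b H≗H′ factor v =
    ≤-trans (proj₁ (factor v)) (≤-reflexive (deg-cong v H≗H′)) ,
    ≤-trans (≤-reflexive (sym (deg-cong v H≗H′))) (proj₂ (factor v))

  factor? : ∀ a b → Decidable (IsFactor G a b)
  factor? a b H = all? λ v → (a ≤? deg G H v) ×-dec (deg G H v ≤? b)

  -- The edges at a vertex get distinct colours, so a proper colouring
  -- with k colours bounds every degree by k.
  degree-bound : ∀ {k H c} → Proper k H c → ∀ v → deg G H v ≤ k
  degree-bound {k} {H} {c} proper v = ≤-trans
    (count-injection (H at v) (const true) (λ e _ → c e) (λ _ _ → refl) distinct)
    (≤-reflexive (count-true k))
    where
    distinct : ∀ e f → (H at v) e ≡ true → (H at v) f ≡ true → c e ≡ c f → e ≡ f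
    distinct e f ev fv ce≡cf with e ≟ f
    ... | yes e≡f = e≡f
    ... | no e≢f =
      let He , e∋v = at-elim H v e ev ; Hf , f∋v = at-elim H v f fv
      in contradiction ce≡cf (proper e f e≢f He Hf (v , e∋v , f∋v))

  free-colour : ∀ {k} H (c : Edge → Fin k) u → deg G H u < k →
    ∃ λ j → ∀ f → (H at u) f ≡ true → c f ≢ j
  free-colour {k} H c u small
    with any? (λ j → all? (λ f → ((H at u) f Bool.≟ true) →-dec ¬? (c f ≟ j)))
  ... | yes free = free
  ... | no none = contradiction all-used (<⇒≱ small)
    where
    used : ∀ j → ∃ λ f → (H at u) f ≡ true × c f ≡ j
    used j with any? (λ f → ((H at u) f Bool.≟ true) ×-dec (c f ≟ j))
    ... | yes w = w
    ... | no ¬w = ⊥-elim (none (j , λ f fu cf≡j → ¬w (f , fu , cf≡j)))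
    all-used : k ≤ deg G H u
    all-used = ≤-trans (≤-reflexive (sym (count-true k)))
      (count-injection (const true) (H at u) (λ j _ → proj₁ (used j)) (λ j _ → proj₁ (proj₂ (used j)))
        (λ i j _ _ fi≡fj → trans (sym (proj₂ (proj₂ (used i))))
                             (trans (cong c fi≡fj) (proj₂ (proj₂ (used j))))))

  recolour : ∀ {k H c} → Proper k H c → ∀ e j H′ →
    (∀ i → i ≢ e → H′ i ≡ true → H i ≡ true) →
    (∀ b → b ≢ e → H′ b ≡ true → Adjacent G e b → c b ≢ j) →
    Proper k H′ (c [ e ]≔ j)
  recolour {c = c} proper e j H′ H′⊆H+e fresh a b a≢b H′a H′b adj with a ≟ e | b ≟ e
  ... | yes refl | yes refl = contradiction refl a≢b
  ... | yes refl | no b≢e = λ eq → fresh b b≢e H′b adj (begin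
        c b            ≡⟨ sym (≔-minimal c a j b b≢e) ⟩
        (c [ a ]≔ j) b ≡⟨ sym eq ⟩
        (c [ a ]≔ j) a ≡⟨ ≔-updates c a j ⟩
        j ∎)
    where open ≡-Reasoning
  ... | no a≢e | yes refl = λ eq → fresh a a≢e H′a (proj₁ adj , proj₂ (proj₂ adj) , proj₁ (proj₂ adj)) (begin
        c a            ≡⟨ sym (≔-minimal c b j a a≢e) ⟩
        (c [ b ]≔ j) a ≡⟨ eq ⟩
        (c [ b ]≔ j) b ≡⟨ ≔-updates c b j ⟩
        j ∎)
    where open ≡-Reasoning
  ... | no a≢e | no b≢e = λ eq → proper a b a≢b (H′⊆H+e a a≢e H′a) (H′⊆H+e b b≢e H′b) adj (begin
        c a            ≡⟨ sym (≔-minimal c e j a a≢e) ⟩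
        (c [ e ]≔ j) a ≡⟨ eq ⟩
        (c [ e ]≔ j) b ≡⟨ ≔-minimal c e j b b≢e ⟩
        c b ∎)
    where open ≡-Reasoning

  -- Local surgery around an edge e = vu whose end v is not covered by H:
  -- every edge of H adjacent to e is at u, so only the colours at u matter.
  module AtUncovered {k H c} (proper : Proper k H c) {v u e}
    (uncovered : ¬ (1 ≤ deg G H v)) (e∋v : incident G e v ≡ true)
    (e⊆vu : ∀ x → incident G e x ≡ true → x ≡ v ⊎ x ≡ u) where

    e∉H : H e ≡ false
    e∉H with H e in He
    ... | false = refl
    ... | true  = contradiction (covers H v e He e∋v) uncovered

    adjacent-at-u : ∀ b → H b ≡ true → Adjacent G e b → (H at u) b ≡ true
    adjacent-at-u b Hb (x , e∋x , b∋x) with e⊆vu x e∋x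
    ... | inj₁ refl = contradiction (covers H x b Hb b∋x) uncovered
    ... | inj₂ refl = at-intro H x b Hb b∋x

    add-edge : ∀ j → (∀ f → (H at u) f ≡ true → c f ≢ j) →
      EdgeColorable G k (H [ e ]≔ true) × size G (H [ e ]≔ true) ≡ suc (size G H)
    add-edge j free = (c [ e ]≔ j , recolour proper e j _ H+e⊆H+e fresh) , count-insert H e e∉H
      where
      H+e⊆H+e : ∀ i → i ≢ e → (H [ e ]≔ true) i ≡ true → H i ≡ true
      H+e⊆H+e i i≢e H+e-i = trans (sym (≔-minimal H e true i i≢e)) H+e-i
      fresh : ∀ b → b ≢ e → (H [ e ]≔ true) b ≡ true → Adjacent G e b → c b ≢ j
      fresh b b≢e H+e-b adj = free b (adjacent-at-u b (H+e⊆H+e b b≢e H+e-b) adj)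

    swap-edge : ∀ f → (H at u) f ≡ true →
      EdgeColorable G k (exchange H f e) × size G (exchange H f e) ≡ size G H
    swap-edge f f-at-u =
      (c [ e ]≔ c f , recolour proper e (c f) _ (λ i i≢e → proj₂ ∘ kept i i≢e) fresh) ,
      count-exchange H f e Hf e∉H
      where
      Hf = proj₁ (at-elim H u f f-at-u)
      kept : ∀ i → i ≢ e → exchange H f e i ≡ true → i ≢ f × H i ≡ true
      kept i i≢e Hx-i with i ≟ f | trans (sym (≔-minimal (H [ f ]≔ false) e true i i≢e)) Hx-i
      ... | yes refl | H-f-i = contradiction (trans (sym (≔-updates H i false)) H-f-i) λ ()
      ... | no i≢f   | H-f-i = i≢f , trans (sym (≔-minimal H f false i i≢f)) H-f-i
      fresh : ∀ b → b ≢ e → exchange H f e b ≡ true → Adjacent G e b → c b ≢ c f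
      fresh b b≢e Hx-b adj =
        let b≢f , Hb = kept b b≢e Hx-b
        in proper b f b≢f Hb Hf
             (u , proj₂ (at-elim H u b (adjacent-at-u b Hb adj)) , proj₂ (at-elim H u f f-at-u))

  shared : Subgraph G → Subgraph G → ℕ
  shared F H = count (m G) (λ e → H e ∧ F e)

  Optimal : ℕ → Subgraph G → Subgraph G → Set
  Optimal k F H = IsMaxEdgeColorable G k H ×
    (∀ H′ → EdgeColorable G k H′ → size G H ≤ size G H′ → shared F H′ ≤ shared F H)

  -- If anything is k-colourable, optimal subgraphs exist: first maximise
  -- the size, then the shared among subgraphs of maximum size.
  optimal-exists : ∀ {k} F → ∃ (EdgeColorable G k) → ∃ (Optimal k F)
  optimal-exists {k} F colourable =
    let H₀ , col₀ , max₀ = maximise searchable-Bool (EdgeColorable G k) (colourable-ext k)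
                             (colourable? k) (size G) count-cong (m G) count-≤ colourable
        H , (col , H₀≤H) , best = maximise searchable-Bool (AtLeast H₀) (at-least-ext H₀)
                             (at-least? H₀) (shared F) shared-cong (m G) (λ _ → count-≤ _)
                             (H₀ , col₀ , ≤-refl)
    in H , (col , λ H′ col′ → ≤-trans (max₀ H′ col′) H₀≤H) ,
       λ H′ col′ H≤H′ → best H′ (col′ , ≤-trans H₀≤H H≤H′)
    where
    AtLeast : Subgraph G → Subgraph G → Set
    AtLeast H₀ H = EdgeColorable G k H × size G H₀ ≤ size G H
    at-least-ext : ∀ H₀ → Extensional (AtLeast H₀)
    at-least-ext H₀ H≗H′ (col , le) = colourable-ext k H≗H′ col , ≤-trans le (≤-reflexive (count-cong H≗H′))
    at-least? : ∀ H₀ → Decidable (AtLeast H₀)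
    at-least? H₀ H = colourable? k H ×-dec (size G H₀ ≤? size G H)
    shared-cong : ∀ {H H′} → H ≗ H′ → shared F H ≡ shared F H′
    shared-cong H≗H′ = count-cong (λ e → cong (_∧ F e) (H≗H′ e))

  optimal-spans : ∀ {k F H} → IsFactor G 1 k F → Optimal k F H → IsSpanning G H
  optimal-spans {k} {F} {H} factor (((c , proper) , maximum) , most-shared) v with 1 ≤? deg G H v
  ... | yes covered = covered
  ... | no uncovered = refute (edge-at F v (proj₁ (factor v)))
    where
    refute : (∃ λ e → F e ≡ true × incident G e v ≡ true) → 1 ≤ deg G H v
    refute (e , Fe , e∋v) with other-end e v e∋v
    ... | u , e∋u , e⊆vu = ⊥-elim (by-degree-at-u (deg G H u <? k))
      where
      open AtUncovered proper uncovered e∋v e⊆vu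
      by-degree-at-u : Dec (deg G H u < k) → ⊥
      by-degree-at-u (yes room) =
        let j , free = free-colour H c u room ; col , grown = add-edge j free
        in n≮n (size G H) (≤-trans (≤-reflexive (sym grown)) (maximum _ col))
      by-degree-at-u (no full) =
        let f , f-at-u , f∉F-at-u = count-surplus (H at u) (F at u) e
                                       (≤-trans (proj₂ (factor u)) (≮⇒≥ full))
                                       (at-intro F u e Fe e∋u) (at-absent H u e e∉H)
            Ff = at-outside F u f f∉F-at-u (proj₂ (at-elim H u f f-at-u))
            col , same-size = swap-edge f f-at-u
        in n≮n (shared F H)
             (≤-trans (≤-reflexive (sym (count-exchange-∧ H F f e e∉H Ff Fe)))
                      (most-shared _ col (≤-reflexive (sym same-size))))

  -- Some subgraph is k-colourable because
  -- the edgeless one is, and k ≥ 1 as soon as there is an edge.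
  sp1⇒sp3 : ∀ k → SP1 G k → SP3 G k
  sp1⇒sp3 k (F , factor) =
    let H , optimal = optimal-exists F (const false , some-colour , λ _ _ _ ())
    in H , optimal-spans factor optimal , proj₁ optimal
    where
    some-colour : Edge → Fin k
    some-colour e = let x = proj₁ (ends G e) in fromℕ< (≤-trans (proj₁ (factor x)) (proj₂ (factor x)))

  sp3⇒sp2 : ∀ k → SP3 G k → SP2 G k
  sp3⇒sp2 k (H , spanning , colourable , _) = H , spanning , colourable

  sp2⇒sp1 : ∀ k → SP2 G k → SP1 G k
  sp2⇒sp1 k (H , spanning , c , proper) = H , λ v → spanning v , degree-bound proper v

  sp1? : Decidable (SP1 G)
  sp1? k = search-functions searchable-Bool (m G) (IsFactor G 1 k) (factor-ext 1 k) (factor? 1 k)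

  whole-graph-factor : NoIsolated G → SP1 G (m G)
  whole-graph-factor no-isolated =
    const true , λ v → count-positive _ (proj₁ (no-isolated v)) (proj₂ (no-isolated v)) , count-≤ _

IsMin-transfer : ∀ {P Q : ℕ → Set} {k} → (∀ j → P j → Q j) → (∀ j → Q j → P j) → IsMin P k → IsMin Q k
IsMin-transfer P⇒Q Q⇒P (pk , least-k) = P⇒Q _ pk , λ j qj → least-k j (Q⇒P j qj)

mainTheorem2 : (G : Graph) → NoIsolated G →
    ∃ λ (k : ℕ) → IsMin (SP1 G) k × IsMin (SP2 G) k × IsMin (SP3 G) k
mainTheorem2 G no-isolated =
  let k , sp₁-min = least (sp1? G) (m G) (whole-graph-factor G no-isolated)
  in k , sp₁-min ,
     IsMin-transfer (λ j → sp3⇒sp2 G j ∘ sp1⇒sp3 G j) (sp2⇒sp1 G) sp₁-min ,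
     IsMin-transfer (sp1⇒sp3 G) (λ j → sp2⇒sp1 G j ∘ sp3⇒sp2 G j) sp₁-min
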